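{- Let $m\ge2$ and $m<r<2m$. Then there is no independent exact $r$-cover of $\mathbb Z^m$.
   Context: $\mathbb Z^m$ is the infinite grid graph: two points are adjacent iff they differ by $\pm1$ in exactly one coordinate. For a $d$-regular graph $G$ and $0\le r\le d$, a set $S\subseteq V(G)$ is an independent exact $r$-cover if $S$ is an independent set and every vertex not in $S$ is adjacent to exactly $r$ elements of $S$. -}

module Defs where

open import Data.Nat using (ℕ)
open import Data.Integer using (ℤ; _+_; _-_; 1ℤ)
open import Data.Fin using (Fin)
open import Data.Bool using (Bool; true; false; if_then_else_)
open import Data.Product using (Σ; ∃; _×_; _,_)
open import Data.Vec.Functional using (Vector; updateAt)
open import Relation.Binary.PropositionalEquality using (_≡_)
open import Relation.Nullary using (¬_)
open import Function.Definitions using (Injective)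
open import Level using (Level; suc; _⊔_)

Point : ℕ → Set
Point m = Vector ℤ m

-- A direction: a coordinate i and a sign (true = +1, false = -1).
-- The 2m neighbours of u in ℤ^m are exactly  nbr u d  for the 2m directions d,
-- and distinct directions give distinct neighbours.
Dir : ℕ → Set
Dir m = Fin m × Bool

nbr : ∀ {m} → Point m → Dir m → Point m
nbr u (i , b) = updateAt u i (λ x → if b then x + 1ℤ else x - 1ℤ)

Adjacent : ∀ {m} → Point m → Point m → Set
Adjacent {m} u v = Σ (Dir m) λ d → ∀ j → v j ≡ nbr u d j

Independent : ∀ {m ℓ} → (Point m → Set ℓ) → Set ℓ
Independent {m} S = ∀ u v → Adjacent u v → S u → ¬ S v

-- u has exactly r neighbours in S: the directions d with  nbr u d ∈ S
-- are enumerated without repetition by some f : Fin r → Dir m.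
ExactlyNeighboursIn : ∀ {m ℓ} → (Point m → Set ℓ) → ℕ → Point m → Set ℓ
ExactlyNeighboursIn {m} S r u =
  Σ (Fin r → Dir m) λ f →
    Injective _≡_ _≡_ f
    × (∀ k → S (nbr u (f k)))
    × (∀ d → S (nbr u d) → ∃ λ k → f k ≡ d)

IndependentExactCover : ∀ {ℓ} (m r : ℕ) → (Point m → Set ℓ) → Set ℓ
IndependentExactCover m r S =
  Independent S × (∀ u → ¬ S u → ExactlyNeighboursIn S r u)

{-# OPTIONS --safe #-}
module Submission where

-- Let x ∉ S. Since r < 2m, some neighbour y = x + e of x is also outside S. If
-- x + d ∈ S, then y + d is adjacent to x + d (it differs by e), so y + d ∉ S.
-- Hence the r directions of S-neighbours of x and the r directions of
-- S-neighbours of y are disjoint, giving 2r ≤ 2m, contrary to m < r. So every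
-- point lies in S, which contradicts independence.

open import Defs
open import Data.Nat using (ℕ; _≤_; _<_; _*_; _+_; s≤s)
open import Data.Product using (∃; _,_; proj₁; proj₂)
open import Relation.Nullary using (¬_; yes; no)

open import Data.Bool using (Bool; true; false; if_then_else_)
open import Data.Empty using (⊥-elim)
open import Data.Fin using (Fin; zero; suc; splitAt; _≟_)
open import Data.Fin.Properties using (*↔×; 2↔Bool; +↔⊎; injective⇒≤; all?; any?; ¬∀⟶∃¬)
open import Data.Integer as ℤ using (ℤ; 0ℤ; 1ℤ)
open import Data.Integer.Properties using (+-assoc; +-comm)
open import Data.Nat.Properties using (<⇒≱; +-mono-<; +-identityʳ)
open import Data.Product.Algebra using (×-comm)
open import Data.Product.Function.NonDependent.Propositional using (_×-↔_)
open import Data.Sum using (inj₁; inj₂; [_,_]′)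
open import Data.Vec.Functional using (Vector; updateAt; head; tail)
open import Function using (_∘_; _↔_; Inverse)
open import Function.Construct.Composition using (_↔-∘_)
open import Function.Construct.Identity using (↔-id)
open import Function.Construct.Symmetry using (↔-sym)
open import Function.Definitions using (Injective)
open import Function.Properties.Inverse using (↔⇒↣)
open import Function.Bundles using (Injection)
open import Relation.Binary.PropositionalEquality
  using (_≡_; _≢_; _≗_; refl; sym; trans; cong; subst)

updateAt-comm : ∀ {a} {A : Set a} {n} (xs : Vector A n) (i j : Fin n) {f g : A → A} →
                (i ≡ j → g ∘ f ≗ f ∘ g) →
                updateAt (updateAt xs i f) j g ≗ updateAt (updateAt xs j g) i f
updateAt-comm xs zero    zero    fg zero    = fg refl (head xs)
updateAt-comm xs zero    zero    fg (suc k) = refl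
updateAt-comm xs zero    (suc j) fg zero    = refl
updateAt-comm xs zero    (suc j) fg (suc k) = refl
updateAt-comm xs (suc i) zero    fg zero    = refl
updateAt-comm xs (suc i) zero    fg (suc k) = refl
updateAt-comm xs (suc i) (suc j) fg zero    = refl
updateAt-comm xs (suc i) (suc j) fg (suc k) = updateAt-comm (tail xs) i j (fg ∘ cong suc) k

[,]-injective : ∀ {a b c} {A : Set a} {B : Set b} {C : Set c} {f : A → C} {g : B → C} →
                Injective _≡_ _≡_ f → Injective _≡_ _≡_ g → (∀ x y → f x ≢ g y) →
                Injective _≡_ _≡_ [ f , g ]′
[,]-injective f-inj g-inj f≢g {inj₁ x} {inj₁ y} eq = cong inj₁ (f-inj eq)
[,]-injective f-inj g-inj f≢g {inj₁ x} {inj₂ y} eq with () ← f≢g x y eq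
[,]-injective f-inj g-inj f≢g {inj₂ x} {inj₁ y} eq with () ← f≢g y x (sym eq)
[,]-injective f-inj g-inj f≢g {inj₂ x} {inj₂ y} eq = cong inj₂ (g-inj eq)

module FiniteType {a} {A : Set a} {n : ℕ} (A↔Fin : A ↔ Fin n) where
  open Inverse A↔Fin using (to; from; strictlyInverseˡ)

  to-injective : Injective _≡_ _≡_ to
  to-injective = Injection.injective (↔⇒↣ A↔Fin)

  ∃-outside-image : ∀ {r} → r < n → (f : Fin r → A) → ∃ λ x → ∀ k → f k ≢ x
  ∃-outside-image {r} r<n f with all? (λ c → any? (λ k → to (f k) ≟ c))
  ... | yes hit = ⊥-elim (<⇒≱ r<n (injective⇒≤ section-injective))
    where
    section-injective : Injective _≡_ _≡_ (proj₁ ∘ hit)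
    section-injective {c} {c′} eq =
      trans (sym (proj₂ (hit c))) (trans (cong (to ∘ f) eq) (proj₂ (hit c′)))
  ... | no ¬hit with c , c-missed ← ¬∀⟶∃¬ n _ (λ c → any? (λ k → to (f k) ≟ c)) ¬hit =
    from c , λ k eq → c-missed (k , trans (cong to eq) (strictlyInverseˡ c))

  disjoint-injective⇒+≤ : ∀ {r s} {f : Fin r → A} {g : Fin s → A} →
                           Injective _≡_ _≡_ f → Injective _≡_ _≡_ g →
                           (∀ i j → f i ≢ g j) → r + s ≤ n
  disjoint-injective⇒+≤ {r} f-inj g-inj f≢g =
    injective⇒≤ {f = to ∘ [ _ , _ ]′ ∘ splitAt r}
      (Injection.injective (↔⇒↣ +↔⊎) ∘ [,]-injective f-inj g-inj f≢g ∘ to-injective)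

shift : Bool → ℤ → ℤ
shift b x = if b then x ℤ.+ 1ℤ else x ℤ.- 1ℤ

shift-comm : ∀ s t → shift s ∘ shift t ≗ shift t ∘ shift s
shift-comm true  true  x = refl
shift-comm false false x = refl
shift-comm true  false x = ±1-comm x
  where
  ±1-comm : ∀ x → x ℤ.- 1ℤ ℤ.+ 1ℤ ≡ x ℤ.+ 1ℤ ℤ.- 1ℤ
  ±1-comm x = trans (+-assoc x (ℤ.- 1ℤ) 1ℤ)
                (trans (cong (ℤ._+_ x) (+-comm (ℤ.- 1ℤ) 1ℤ)) (sym (+-assoc x 1ℤ (ℤ.- 1ℤ))))
shift-comm false true  x = sym (shift-comm true false x)

nbr-comm : ∀ {m} (x : Point m) (d e : Dir m) → nbr (nbr x d) e ≗ nbr (nbr x e) d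
nbr-comm x (i , s) (j , t) = updateAt-comm x i j (λ _ → shift-comm t s)

nbr-adjacent : ∀ {m} (x : Point m) (d e : Dir m) → Adjacent (nbr x d) (nbr (nbr x e) d)
nbr-adjacent x d e = e , nbr-comm x e d

Dir↔Fin : ∀ {m} → Dir m ↔ Fin (2 * m)
Dir↔Fin {m} = ↔-sym (*↔× {2} {m}) ↔-∘ (×-comm (Fin m) (Fin 2) ↔-∘ (↔-id _ ×-↔ ↔-sym 2↔Bool))

module _ {m r} {S : Point m → Set} (indep : Independent S)
         (cover : ∀ u → ¬ S u → ExactlyNeighboursIn S r u) where

  open FiniteType (Dir↔Fin {m}) using (∃-outside-image; disjoint-injective⇒+≤)

  outside-neighbour : r < 2 * m → ∀ x → ¬ S x → ∃ λ e → ¬ S (nbr x e)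
  outside-neighbour r<2m x x∉S with f , _ , _ , f-complete ← cover x x∉S
    with e , e-missed ← ∃-outside-image r<2m f =
    e , λ x+e∈S → let k , fk≡e = f-complete e x+e∈S in e-missed k fk≡e

  adjacent-outsiders⇒+≤ : ∀ x e → ¬ S x → ¬ S (nbr x e) → r + r ≤ 2 * m
  adjacent-outsiders⇒+≤ x e x∉S y∉S
    with f , f-inj , f-in , _ ← cover x x∉S
       | g , g-inj , g-in , _ ← cover (nbr x e) y∉S =
    disjoint-injective⇒+≤ f-inj g-inj f≢g
    where
    f≢g : ∀ i j → f i ≢ g j
    f≢g i j fi≡gj = indep _ _ (nbr-adjacent x (f i) e) (f-in i)
                      (subst (S ∘ nbr (nbr x e)) (sym fi≡gj) (g-in j))

  no-outsiders : r < 2 * m → m < r → ∀ x → ¬ ¬ S x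
  no-outsiders r<2m m<r x x∉S with e , y∉S ← outside-neighbour r<2m x x∉S =
    <⇒≱ (+-mono-< m<r m<r) (subst (r + r ≤_) 2*m≡m+m (adjacent-outsiders⇒+≤ x e x∉S y∉S))
    where
    2*m≡m+m : 2 * m ≡ m + m
    2*m≡m+m = cong (m +_) (+-identityʳ m)

theorem6 : (m r : ℕ) → 2 ≤ m → m < r → r < 2 * m →
    ¬ (∃ λ (S : Point m → Set) → IndependentExactCover m r S)
theorem6 m r (s≤s _) m<r r<2m (S , indep , cover) =
  every∈S origin (λ origin∈S → every∈S y (indep origin y (e , λ _ → refl) origin∈S))
  where
  every∈S : ∀ x → ¬ ¬ S x
  every∈S = no-outsiders indep cover r<2m m<r
  origin : Point m
  origin _ = 0ℤ
  e : Dir m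
  e = zero , true
  y : Point m
  y = nbr origin e
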